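{- Let $G$ and $H$ be connected non complete graphs and consider the corona product graph $G\circ H$, in which $G$ is identified with its copy. Let $g_1,g_2,g\in V(G)$ with $g_1g_2\notin E(G)$. Then $g\in WT_G(g_1,g_2)$ if and only if $g\in WT_{G\circ H}(g_1,g_2)$.
   Context: All graphs are finite, simple, connected and have at least two vertices. For vertices $u,v$ of a graph $G$, a weakly toll walk between $u$ and $v$ is a sequence $u=w_0,w_1,\ldots,w_k=v$ ($k\ge 0$) such that, when $k>0$: $w_iw_{i+1}\in E(G)$ for all $i\in\{0,\ldots,k-1\}$; $uw_i\in E(G)$ with $i\in\{1,\ldots,k\}$ implies $w_i=w_1$; and $w_iv\in E(G)$ with $i\in\{0,\ldots,k-1\}$ implies $w_i=w_{k-1}$. $WT_G(u,v)$ is the set of vertices lying on some weakly toll walk between $u$ and $v$ in $G$. The corona product $G\circ H$ is obtained from one copy of $G$ (with $V(G)=\{g_1,\ldots,g_n\}$) and $n$ disjoint copies $H^1,\ldots,H^n$ of $H$ by joining $g_i$ to every vertex of $H^i$, for each $i$. -}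

module Defs where

open import Level using (0ℓ)
open import Data.Nat using (ℕ; zero; suc)
open import Data.Fin using (Fin; zero; suc; inject₁; fromℕ)
open import Data.Product using (Σ; _×_; _,_; ∃)
open import Data.Sum using (_⊎_; inj₁; inj₂)
open import Data.Empty using (⊥)
open import Relation.Nullary using (¬_)
open import Relation.Binary.PropositionalEquality using (_≡_)

record Graph (V : Set) : Set₁ where
  field
    Adj    : V → V → Set
    sym    : ∀ {u v} → Adj u v → Adj v u
    irrefl : ∀ {v} → ¬ Adj v v
open Graph public using (Adj)

IsWalk : ∀ {V} → Graph V → (k : ℕ) → (Fin (suc k) → V) → Set
IsWalk G k w = (i : Fin k) → Adj G (w (inject₁ i)) (w (suc i))

Connected : ∀ {V} → Graph V → Set
Connected {V} G = (u v : V) → Σ ℕ λ k → Σ (Fin (suc k) → V) λ w →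
  IsWalk G k w × w zero ≡ u × w (fromℕ k) ≡ v

NonComplete : ∀ {V} → Graph V → Set
NonComplete {V} G = Σ V λ u → Σ V λ v → ¬ (u ≡ v) × ¬ Adj G u v

-- weakly toll walk between u and v (the sequence w 0 = u, ..., w k = v)
--  k = 0 : the trivial walk (then u = v)
--  k > 0 : walk, u adjacent to w i (i ≥ 1) implies w i = w 1,
--          w i adjacent to v (i ≤ k-1) implies w i = w (k-1)
IsWeaklyTollWalk : ∀ {V} → Graph V → V → V → (k : ℕ) → (Fin (suc k) → V) → Set
IsWeaklyTollWalk G u v zero w = w zero ≡ u × w zero ≡ v
IsWeaklyTollWalk G u v (suc j) w =
  w zero ≡ u × w (fromℕ (suc j)) ≡ v × IsWalk G (suc j) w ×
  ((i : Fin (suc j)) → Adj G u (w (suc i)) → w (suc i) ≡ w (suc zero)) ×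
  ((i : Fin (suc j)) → Adj G (w (inject₁ i)) v → w (inject₁ i) ≡ w (inject₁ (fromℕ j)))

InWT : ∀ {V} → Graph V → V → V → V → Set
InWT {V} G u v x = Σ ℕ λ k → Σ (Fin (suc k) → V) λ w →
  IsWeaklyTollWalk G u v k w × Σ (Fin (suc k)) λ i → w i ≡ x

-- corona product G ∘ H: vertices of G are inj₁ g, the copy H^i has vertices inj₂ (i , h)
CoronaAdj : ∀ {A B : Set} → Graph A → Graph B → (A ⊎ (A × B)) → (A ⊎ (A × B)) → Set
CoronaAdj G H (inj₁ a) (inj₁ a') = Adj G a a'
CoronaAdj G H (inj₁ a) (inj₂ (i , h)) = a ≡ i
CoronaAdj G H (inj₂ (i , h)) (inj₁ a) = i ≡ a
CoronaAdj G H (inj₂ (i , h)) (inj₂ (i' , h')) = i ≡ i' × Adj H h h'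

corona : ∀ {A B : Set} → Graph A → Graph B → Graph (A ⊎ (A × B))
corona G H = record { Adj = CoronaAdj G H ; sym = λ {u} {v} → s {u} {v} ; irrefl = λ {v} → ir {v} }
  where
  open import Relation.Binary.PropositionalEquality using () renaming (sym to ≡sym)
  s : ∀ {u v} → CoronaAdj G H u v → CoronaAdj G H v u
  s {inj₁ a} {inj₁ a'} p = Graph.sym G p
  s {inj₁ a} {inj₂ _} p = ≡sym p
  s {inj₂ _} {inj₁ a} p = ≡sym p
  s {inj₂ _} {inj₂ _} (e , p) = ≡sym e , Graph.sym H p
  ir : ∀ {v} → ¬ CoronaAdj G H v v
  ir {inj₁ a} p = Graph.irrefl G p
  ir {inj₂ _} (_ , p) = Graph.irrefl H p

-- A vertex x lies on a weakly toll u–v walk exactly when there are vertices a, b (the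
-- second and the penultimate vertex of the walk) and a u–v walk through x on which every
-- neighbour of u is a and every neighbour of v is b.  This reformulation transfers to the
-- corona product: a walk of G is a walk of G ∘ H, and conversely a walk of G ∘ H is sent
-- to a walk of G through the same G-vertices by collapsing each copy Hⁱ onto gᵢ, its only
-- neighbour outside Hⁱ.
module Submission where

open import Defs
open import Data.Nat using (ℕ; zero; suc)
open import Data.Fin using (Fin; zero; suc; inject₁; fromℕ)
open import Data.Sum using (_⊎_; inj₁; inj₂)
open import Data.Product using (∃; ∃₂; _×_; _,_; proj₁; proj₂)
open import Data.Empty using (⊥-elim)
open import Function using (id; _∘_)
open import Function.Bundles using (_⇔_; mk⇔)
open import Function.Properties.Equivalence using () renaming (sym to ⇔-sym; trans to ⇔-trans)
open import Relation.Nullary using (¬_)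
open import Relation.Binary.PropositionalEquality using (_≡_; refl; sym; trans; cong; subst; subst₂)

fromℕ-or-inject₁ : ∀ {n} (i : Fin (suc n)) → i ≡ fromℕ n ⊎ ∃ λ j → i ≡ inject₁ j
fromℕ-or-inject₁ {zero}  zero    = inj₁ refl
fromℕ-or-inject₁ {suc n} zero    = inj₂ (zero , refl)
fromℕ-or-inject₁ {suc n} (suc i) with fromℕ-or-inject₁ i
... | inj₁ i≡last     = inj₁ (cong suc i≡last)
... | inj₂ (j , i≡j) = inj₂ (suc j , cong suc i≡j)

data WalkWithin {V : Set} (G : Graph V) (P : V → Set) : V → V → Set where
  [_]  : ∀ {s} → P s → WalkWithin G P s s
  step : ∀ {s y z} → Adj G s y → P s → WalkWithin G P y z → WalkWithin G P s z

module _ {V : Set} {G : Graph V} {P : V → Set} where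

  start-within : ∀ {s z} → WalkWithin G P s z → P s
  start-within [ p ]        = p
  start-within (step _ p _) = p

  _++_ : ∀ {s x z} → WalkWithin G P s x → WalkWithin G P x z → WalkWithin G P s z
  [ _ ]       ++ r′ = r′
  step sy p r ++ r′ = step sy p (r ++ r′)

  length : ∀ {s z} → WalkWithin G P s z → ℕ
  length [ _ ]        = zero
  length (step _ _ r) = suc (length r)

  vertexAt : ∀ {s z} (r : WalkWithin G P s z) → Fin (suc (length r)) → V
  vertexAt ([_] {s} _)      zero    = s
  vertexAt (step {s} _ _ _) zero    = s
  vertexAt (step _ _ r)     (suc i) = vertexAt r i

  vertexAt-start : ∀ {s z} (r : WalkWithin G P s z) → vertexAt r zero ≡ s
  vertexAt-start [ _ ]        = refl
  vertexAt-start (step _ _ _) = refl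

  vertexAt-end : ∀ {s z} (r : WalkWithin G P s z) → vertexAt r (fromℕ (length r)) ≡ z
  vertexAt-end [ _ ]        = refl
  vertexAt-end (step _ _ r) = vertexAt-end r

  vertexAt-isWalk : ∀ {s z} (r : WalkWithin G P s z) → IsWalk G (length r) (vertexAt r)
  vertexAt-isWalk (step {s} sy _ r) zero    = subst (Adj G s) (sym (vertexAt-start r)) sy
  vertexAt-isWalk (step _ _ r)      (suc i) = vertexAt-isWalk r i

  vertexAt-within : ∀ {s z} (r : WalkWithin G P s z) i → P (vertexAt r i)
  vertexAt-within [ p ]        zero    = p
  vertexAt-within (step _ p _) zero    = p
  vertexAt-within (step _ _ r) (suc i) = vertexAt-within r i

  ++-passes-through : ∀ {s x z} (r : WalkWithin G P s x) (r′ : WalkWithin G P x z) →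
                      ∃ λ i → vertexAt (r ++ r′) i ≡ x
  ++-passes-through [ _ ]        r′ = zero , vertexAt-start r′
  ++-passes-through (step _ _ r) r′ with ++-passes-through r r′
  ... | i , eq = suc i , eq

  prefix-within : ∀ {k} (w : Fin (suc k) → V) → IsWalk G k w → (∀ i → P (w i)) →
                  ∀ i → WalkWithin G P (w zero) (w i)
  prefix-within         w walk within zero    = [ within zero ]
  prefix-within {suc k} w walk within (suc i) =
    step (walk zero) (within zero) (prefix-within (w ∘ suc) (walk ∘ suc) (within ∘ suc) i)

  suffix-within : ∀ {k} (w : Fin (suc k) → V) → IsWalk G k w → (∀ i → P (w i)) →
                  ∀ i → WalkWithin G P (w i) (w (fromℕ k))
  suffix-within {k}     w walk within zero    = prefix-within w walk within (fromℕ k)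
  suffix-within {suc k} w walk within (suc i) = suffix-within (w ∘ suc) (walk ∘ suc) (within ∘ suc) i

WalkWithin-map : ∀ {V W : Set} {G : Graph V} {G′ : Graph W} {P : V → Set} {Q : W → Set}
                 (f : V → W) → (∀ {x y} → Adj G x y → Adj G′ (f x) (f y)) → (∀ {y} → P y → Q (f y)) →
                 ∀ {s z} → WalkWithin G P s z → WalkWithin G′ Q (f s) (f z)
WalkWithin-map f f-adj f-within [ p ]         = [ f-within p ]
WalkWithin-map f f-adj f-within (step sy p r) =
  step (f-adj sy) (f-within p) (WalkWithin-map f f-adj f-within r)

module _ {V : Set} (G : Graph V) (u v : V) where

  Gated : V → V → V → Set
  Gated a b y = (Adj G u y → y ≡ a) × (Adj G y v → y ≡ b)

  TollReachable : V → Set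
  TollReachable x = ∃₂ λ a b → WalkWithin G (Gated a b) u x × WalkWithin G (Gated a b) x v

  gated⇒weaklyToll : ∀ {a b k} (w : Fin (suc k) → V) → IsWalk G k w → w zero ≡ u → w (fromℕ k) ≡ v →
                     (∀ i → Gated a b (w i)) → IsWeaklyTollWalk G u v k w
  gated⇒weaklyToll {k = zero}     w walk start end gated = start , end
  gated⇒weaklyToll {a} {b} {suc j} w walk start end gated =
    start , end , walk , to-second , to-penultimate
    where
    second≡a : w (suc zero) ≡ a
    second≡a = proj₁ (gated (suc zero)) (subst (λ t → Adj G t (w (suc zero))) start (walk zero))
    penultimate≡b : w (inject₁ (fromℕ j)) ≡ b
    penultimate≡b = proj₂ (gated (inject₁ (fromℕ j))) (subst (Adj G _) end (walk (fromℕ j)))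
    to-second : (i : Fin (suc j)) → Adj G u (w (suc i)) → w (suc i) ≡ w (suc zero)
    to-second i u~wi = trans (proj₁ (gated (suc i)) u~wi) (sym second≡a)
    to-penultimate : (i : Fin (suc j)) → Adj G (w (inject₁ i)) v → w (inject₁ i) ≡ w (inject₁ (fromℕ j))
    to-penultimate i wi~v = trans (proj₂ (gated (inject₁ i)) wi~v) (sym penultimate≡b)

  weaklyToll⇒gated : ∀ {j} (w : Fin (suc (suc j)) → V) → IsWeaklyTollWalk G u v (suc j) w →
                     ∀ i → Gated (w (suc zero)) (w (inject₁ (fromℕ j))) (w i)
  weaklyToll⇒gated {j} w (start , end , walk , to-second , to-penultimate) i = near-u i , near-v i
    where
    near-u : ∀ i → Adj G u (w i) → w i ≡ w (suc zero)
    near-u zero    u~u  = ⊥-elim (Graph.irrefl G (subst (Adj G u) start u~u))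
    near-u (suc i) u~wi = to-second i u~wi
    near-v : ∀ i → Adj G (w i) v → w i ≡ w (inject₁ (fromℕ j))
    near-v i wi~v with fromℕ-or-inject₁ i
    ... | inj₁ refl        = ⊥-elim (Graph.irrefl G (subst (λ t → Adj G t v) end wi~v))
    ... | inj₂ (i′ , refl) = to-penultimate i′ wi~v

  stationary : ∀ {x} → x ≡ u → u ≡ v → TollReachable x
  stationary refl refl = u , u , [ gated ] , [ gated ]
    where
    gated : Gated u u u
    gated = (λ _ → refl) , (λ _ → refl)

  InWT⇒TollReachable : ∀ {x} → InWT G u v x → TollReachable x
  InWT⇒TollReachable (zero , w , (start , end) , zero , w≡x) =
    stationary (trans (sym w≡x) start) (trans (sym start) end)
  InWT⇒TollReachable (suc j , w , toll@(start , end , walk , _) , i , w≡x) =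
    _ , _ , subst₂ (WalkWithin G _) start w≡x (prefix-within w walk gated i)
          , subst₂ (WalkWithin G _) w≡x end (suffix-within w walk gated i)
    where
    gated : ∀ i → Gated (w (suc zero)) (w (inject₁ (fromℕ j))) (w i)
    gated = weaklyToll⇒gated w toll

  TollReachable⇒InWT : ∀ {x} → TollReachable x → InWT G u v x
  TollReachable⇒InWT (a , b , r , r′) =
    length (r ++ r′) , vertexAt (r ++ r′) ,
    gated⇒weaklyToll (vertexAt (r ++ r′)) (vertexAt-isWalk (r ++ r′)) (vertexAt-start (r ++ r′))
                     (vertexAt-end (r ++ r′)) (vertexAt-within (r ++ r′)) ,
    ++-passes-through r r′

InWT⇔TollReachable : ∀ {V} (G : Graph V) {u v x : V} → InWT G u v x ⇔ TollReachable G u v x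
InWT⇔TollReachable G = mk⇔ (InWT⇒TollReachable G _ _) (TollReachable⇒InWT G _ _)

module _ {A B : Set} (G : Graph A) (H : Graph B) where

  base : A ⊎ (A × B) → A
  base (inj₁ g)       = g
  base (inj₂ (g , _)) = g

  project : ∀ {P s z} → WalkWithin (corona G H) P s z → P (inj₁ (base s)) →
            WalkWithin G (P ∘ inj₁) (base s) (base z)
  project [ _ ]                                        p = [ p ]
  project (step {inj₁ _} {inj₁ _} sy         _ r) p = step sy p (project r (start-within r))
  project (step {inj₁ _} {inj₂ _} refl       _ r) p = project r p
  project (step {inj₂ _} {inj₁ _} refl       _ r) p = project r p
  project (step {inj₂ _} {inj₂ _} (refl , _) _ r) p = project r p

  inj₁≡⇒≡base : ∀ {g c} → inj₁ g ≡ c → g ≡ base c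
  inj₁≡⇒≡base refl = refl

  module _ {u v : A} where

    corona-TollReachable⁺ : ∀ {x} → TollReachable G u v x →
                            TollReachable (corona G H) (inj₁ u) (inj₁ v) (inj₁ x)
    corona-TollReachable⁺ (a , b , r , r′) = inj₁ a , inj₁ b , embed r , embed r′
      where
      embed : ∀ {s z} → WalkWithin G (Gated G u v a b) s z →
              WalkWithin (corona G H) (Gated (corona G H) (inj₁ u) (inj₁ v) (inj₁ a) (inj₁ b)) (inj₁ s) (inj₁ z)
      embed = WalkWithin-map inj₁ id (λ (near-u , near-v) → cong inj₁ ∘ near-u , cong inj₁ ∘ near-v)

    corona-TollReachable⁻ : ∀ {x} → TollReachable (corona G H) (inj₁ u) (inj₁ v) (inj₁ x) →
                            TollReachable G u v x
    corona-TollReachable⁻ (a , b , r , r′) = base a , base b , descend r , descend r′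
      where
      descend : ∀ {s z} → WalkWithin (corona G H) (Gated (corona G H) (inj₁ u) (inj₁ v) a b) (inj₁ s) (inj₁ z) →
                WalkWithin G (Gated G u v (base a) (base b)) s z
      descend r = WalkWithin-map id id (λ (near-u , near-v) → inj₁≡⇒≡base ∘ near-u , inj₁≡⇒≡base ∘ near-v)
                                 (project r (start-within r))

    corona-TollReachable⇔ : ∀ {x} → TollReachable G u v x ⇔
                                    TollReachable (corona G H) (inj₁ u) (inj₁ v) (inj₁ x)
    corona-TollReachable⇔ = mk⇔ corona-TollReachable⁺ corona-TollReachable⁻

corona-InWT⇔ : ∀ {A B} (G : Graph A) (H : Graph B) {u v x : A} →
               InWT G u v x ⇔ InWT (corona G H) (inj₁ u) (inj₁ v) (inj₁ x)
corona-InWT⇔ G H = ⇔-trans (InWT⇔TollReachable G)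
                     (⇔-trans (corona-TollReachable⇔ G H) (⇔-sym (InWT⇔TollReachable (corona G H))))

mainTheorem6 : (n m : ℕ) (G : Graph (Fin n)) (H : Graph (Fin m)) →
    Connected G → NonComplete G → Connected H → NonComplete H →
    (g₁ g₂ g : Fin n) → ¬ Adj G g₁ g₂ →
    InWT G g₁ g₂ g ⇔ InWT (corona G H) (inj₁ g₁) (inj₁ g₂) (inj₁ g)
mainTheorem6 n m G H _ _ _ _ g₁ g₂ g _ = corona-InWT⇔ G H
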